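{- Let $d_1,\dots,d_q$ be integers with $d_i\ge3$ for all $i$, $N'=\mathrm{lcm}(d_1,\dots,d_q)$, $G=(\mathbb Z/N'\mathbb Z)^\times$, and \[ H=\{g\in G:\ \exists(\varepsilon_i)\in\{\pm1\}^q\text{ such that } g\equiv\varepsilon_i \bmod d_i\ (i=1,\dots,q)\}. \] Then the action of $G$ on $J_{d_1}\times\cdots\times J_{d_q}$ factors through $G/H$, and $G/H$ acts freely on $J_{d_1}\times\cdots\times J_{d_q}$; in particular every $G/H$-orbit has $|G/H|$ elements. Moreover $|H|=2^{\beta_0(\Gamma(V))}$, where $V=\{1,\dots,q\}$ and $\beta_0(\Gamma(V))$ is the number of connected components of $\Gamma(V)$.
   Context: For $d\ge3$, $J_d=\{j\in\mathbb N:j<d/2,\ \gcd(j,d)=1\}$, regarded as a set of representatives of $(\mathbb Z/d\mathbb Z)^\times$ modulo $k\sim-k$. $G$ acts on $J_{d_1}\times\cdots\times J_{d_q}$ componentwise by $a\cdot(j_1,\dots,j_q)=(aj_1,\dots,aj_q)$, where $aj_i$ is reduced mod $d_i$ and replaced by its representative in $J_{d_i}$ modulo $\pm$. $\Gamma(V)$ is the graph on vertex set $V=\{1,\dots,q\}$ with an edge between distinct $i,j$ whenever $\gcd(d_i,d_j)\ge3$. -}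

module Defs where

open import Data.Nat using (ℕ; zero; suc; _+_; _*_; _∸_; _^_; _≤_; _<_; _<ᵇ_)
open import Data.Nat.DivMod using (_%_)
open import Data.Nat.GCD using (gcd)
open import Data.Nat.LCM using (lcm)
open import Data.Bool using (Bool; true; false; if_then_else_)
open import Data.Fin using (Fin)
open import Data.Vec using (Vec; lookup; foldr′; zipWith)
open import Data.List using (List; length)
open import Data.List.Membership.Propositional using (_∈_)
open import Data.List.Relation.Unary.Unique.Propositional using (Unique)
open import Data.Integer as ℤ using (ℤ; +_; -[1+_])
open import Data.Integer.Divisibility using () renaming (_∣_ to _∣ℤ_)
open import Data.Product using (Σ; _×_; ∃)
open import Relation.Binary.PropositionalEquality using (_≡_; _≢_)

lcmAll : ∀ {q} → Vec ℕ q → ℕ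
lcmAll = foldr′ lcm 1

-- membership in G = (ℤ/Nℤ)^× , elements represented by residues 0 ≤ g < N
InG : ℕ → ℕ → Set
InG N g = g < N × gcd g N ≡ 1

_≡_[mod_] : ℤ → ℤ → ℕ → Set
a ≡ b [mod d ] = (+ d) ∣ℤ (a ℤ.- b)

sign : Bool → ℤ
sign true  = + 1
sign false = -[1+ 0 ]

InH : ∀ {q} → Vec ℕ q → ℕ → Set
InH {q} d g = InG (lcmAll d) g ×
  Σ (Vec Bool q) (λ ε → ∀ (i : Fin q) → (+ g) ≡ sign (lookup ε i) [mod lookup d i ])

-- J_d = { j ∈ ℕ : j < d/2 , gcd(j,d) = 1 }
InJ : ℕ → ℕ → Set
InJ d j = 2 * j < d × gcd j d ≡ 1

InJs : ∀ {q} → Vec ℕ q → Vec ℕ q → Set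
InJs {q} d x = ∀ (i : Fin q) → InJ (lookup d i) (lookup x i)

-- representative in J_d of the class of m modulo (k ~ -k): reduce mod d,
-- then replace r by d - r if r > d/2  (junk value for d = 0)
rep : ℕ → ℕ → ℕ
rep zero    m = m
rep (suc n) m = if (2 * r) <ᵇ suc n then r else suc n ∸ r
  where r = m % suc n

actJ : ℕ → ℕ → ℕ → ℕ
actJ d a j = rep d (a * j)

act : ∀ {q} → Vec ℕ q → ℕ → Vec ℕ q → Vec ℕ q
act d a x = zipWith (λ di xi → actJ di a xi) d x

-- G-orbit of x (equal to its G/H-orbit as a set)
InOrbit : ∀ {q} → Vec ℕ q → Vec ℕ q → Vec ℕ q → Set
InOrbit d x y = ∃ λ g → InG (lcmAll d) g × act d g x ≡ y

HasSize : {A : Set} → (A → Set) → ℕ → Set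
HasSize {A} P n = Σ (List A) λ l → Unique l × (∀ x → (x ∈ l → P x) × (P x → x ∈ l)) × length l ≡ n

Adj : ∀ {q} → Vec ℕ q → Fin q → Fin q → Set
Adj d i j = i ≢ j × 3 ≤ gcd (lookup d i) (lookup d j)

data Reach {q} (d : Vec ℕ q) (i : Fin q) : Fin q → Set where
  here : Reach d i i
  step : ∀ {j k} → Reach d i j → Adj d j k → Reach d i k

-- Γ(V) has exactly c connected components: there is a surjective labelling
-- of vertices by Fin c whose fibres are exactly the connected components
NumComponents : ∀ {q} → Vec ℕ q → ℕ → Set
NumComponents {q} d c = Σ (Fin q → Fin c) λ comp →
  (∀ k → ∃ λ i → comp i ≡ k) ×
  (∀ i j → (comp i ≡ comp j → Reach d i j) × (Reach d i j → comp i ≡ comp j))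

module Submission where

-- The representative map rep d m of Defs is the unique j ∈ [0, d/2] with j ≡ ±m
-- (mod d) (rep-spec, rep-fixes).  Hence g·x only depends on g up to sign modulo each
-- dᵢ, which gives (1), and cancelling the unit xᵢ from g xᵢ ≡ ±xᵢ gives (2).  For (3)
-- we count G through the fibres of g ↦ g·x; each fibre is a coset g₀H, in bijection
-- with H.  For (4), an element of H has a constant sign on each component (+1 and
-- -1 are distinct modulo a gcd ≥ 3), and conversely every sign choice per component
-- is realised by a Chinese remainder theorem for non-coprime moduli, since moduli in
-- different components have gcd ≤ 2.  So H ≅ {±1}^c.

open import Defs
open import Data.Nat using (ℕ; zero; suc; _+_; _*_; _^_; _∸_; _≤_; _<_; z≤n; s≤s; NonZero; >-nonZero; _<ᵇ_; _≡ᵇ_)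
import Data.Nat.Properties as ℕP
open import Data.Nat.DivMod using (_%_; m%n<n)
open import Data.Nat.Divisibility as ℕ∣ using (_∣_; divides)
open import Data.Integer as ℤ using (ℤ; +_; -[1+_])
open import Data.Integer.DivMod using (_%ℕ_; _/ℕ_; a≡a%ℕn+[a/ℕn]*n; n%ℕd<d)
import Data.Integer.Properties as ℤP
import Data.Nat.Tactic.RingSolver as ℕ-Ring
import Data.Integer.Divisibility.Signed as ℤ∣
open import Data.Integer.Tactic.RingSolver using (solve-∀)
open import Data.Nat.GCD using (gcd; gcd-GCD; module Bézout; gcd[m,n]∣m; gcd[m,n]∣n; gcd[m,n]≡0⇒m≡0)
open import Data.Nat.LCM using (lcm; m∣lcm[m,n]; n∣lcm[m,n]; lcm-least; gcd*lcm)
open import Data.Nat.Coprimality as Coprime using (Coprime; coprime-divisor; gcd≡1⇒coprime; coprime⇒gcd≡1)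
open import Data.Fin as Fin using (Fin; zero; suc)
open import Data.Vec using (Vec; []; _∷_; lookup; tabulate)
import Data.Vec.Properties as VecP
open import Data.Bool using (Bool; true; false; T; if_then_else_)
open import Data.Unit using (⊤; tt)
open import Data.List using (List; []; _∷_; length; map; filter; _++_)
import Data.List.Properties as ListP
open import Data.List.Relation.Unary.Any using (here; there)
open import Data.List.Relation.Unary.All as All using (All)
import Data.List.Relation.Unary.All.Properties as AllP
open import Data.List.Relation.Unary.AllPairs using ([]; _∷_)
open import Data.List.Membership.Propositional using (_∈_)
open import Data.List.Membership.Propositional.Properties using (∈-map⁺; ∈-map⁻; ∈-filter⁺; ∈-filter⁻; ∈-++⁺ˡ; ∈-++⁺ʳ)
open import Data.List.Membership.Propositional.Properties.WithK using (unique∧set⇒bag)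
open import Data.List.Relation.Unary.Unique.Propositional using (Unique)
import Data.List.Relation.Unary.Unique.Propositional.Properties as UniqueP
open import Data.List.Relation.Binary.BagAndSetEquality using (∼bag⇒↭)
open import Data.List.Relation.Binary.Permutation.Propositional.Properties using (↭-length)
open import Data.Nat.ListAction using (sum)
open import Function.Bundles using (mk⇔)
open import Relation.Nullary using (does; yes; no; contradiction)
open import Relation.Binary.Definitions using (DecidableEquality)
open import Data.Product using (∃; _×_; _,_; proj₁; proj₂)
open import Data.Sum using (_⊎_; inj₁; inj₂)
open import Data.Empty using (⊥; ⊥-elim)
open import Relation.Binary.PropositionalEquality
  using (_≡_; _≢_; refl; sym; trans; cong; cong₂; subst; subst₂; module ≡-Reasoning)

infix 4 _≈_[mod_]

-- Congruence with an explicit quotient: a ≈ b [mod d] means a = b + k·d.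
-- It is an equivalence relation compatible with +, · and negation.
record _≈_[mod_] (a b : ℤ) (d : ℕ) : Set where
  constructor ≈-by
  field
    quotient : ℤ
    equation : a ≡ b ℤ.+ quotient ℤ.* + d

≈-refl : ∀ {d} a → a ≈ a [mod d ]
≈-refl {d} a = ≈-by (+ 0) (identity a (+ d))
  where
  identity : ∀ a d → a ≡ a ℤ.+ + 0 ℤ.* d
  identity = solve-∀

≈-reflexive : ∀ {d a b} → a ≡ b → a ≈ b [mod d ]
≈-reflexive {a = a} refl = ≈-refl a

isolate : ∀ {a} b k d → a ≡ b ℤ.+ k ℤ.* d → b ≡ a ℤ.+ (ℤ.- k) ℤ.* d
isolate b k d refl = identity b k d
  where
  identity : ∀ b k d → b ≡ (b ℤ.+ k ℤ.* d) ℤ.+ (ℤ.- k) ℤ.* d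
  identity = solve-∀

≈-sym : ∀ {d a b} → a ≈ b [mod d ] → b ≈ a [mod d ]
≈-sym {d} {b = b} (≈-by k eq) = ≈-by (ℤ.- k) (isolate b k (+ d) eq)

≈-trans : ∀ {d a b c} → a ≈ b [mod d ] → b ≈ c [mod d ] → a ≈ c [mod d ]
≈-trans {d} {c = c} (≈-by k refl) (≈-by l refl) = ≈-by (l ℤ.+ k) (identity c l k (+ d))
  where
  identity : ∀ c l k d → (c ℤ.+ l ℤ.* d) ℤ.+ k ℤ.* d ≡ c ℤ.+ (l ℤ.+ k) ℤ.* d
  identity = solve-∀

≈-+ : ∀ {d a b a′ b′} → a ≈ b [mod d ] → a′ ≈ b′ [mod d ] → a ℤ.+ a′ ≈ b ℤ.+ b′ [mod d ]
≈-+ {d} {b = b} {b′ = b′} (≈-by k refl) (≈-by l refl) = ≈-by (k ℤ.+ l) (identity b b′ k l (+ d))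
  where
  identity : ∀ b b′ k l d → (b ℤ.+ k ℤ.* d) ℤ.+ (b′ ℤ.+ l ℤ.* d) ≡ (b ℤ.+ b′) ℤ.+ (k ℤ.+ l) ℤ.* d
  identity = solve-∀

≈-*ˡ : ∀ {d a b} c → a ≈ b [mod d ] → c ℤ.* a ≈ c ℤ.* b [mod d ]
≈-*ˡ {d} {b = b} c (≈-by k refl) = ≈-by (c ℤ.* k) (identity b k c (+ d))
  where
  identity : ∀ b k c d → c ℤ.* (b ℤ.+ k ℤ.* d) ≡ c ℤ.* b ℤ.+ (c ℤ.* k) ℤ.* d
  identity = solve-∀

≈-*ʳ : ∀ {d a b} c → a ≈ b [mod d ] → a ℤ.* c ≈ b ℤ.* c [mod d ]
≈-*ʳ {d} {a} {b} c p = subst₂ (_≈_[mod d ]) (ℤP.*-comm c a) (ℤP.*-comm c b) (≈-*ˡ c p)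

≈-* : ∀ {d a b a′ b′} → a ≈ b [mod d ] → a′ ≈ b′ [mod d ] → a ℤ.* a′ ≈ b ℤ.* b′ [mod d ]
≈-* {b = b} {a′ = a′} p q = ≈-trans (≈-*ʳ a′ p) (≈-*ˡ b q)

≈-neg : ∀ {d a b} → a ≈ b [mod d ] → ℤ.- a ≈ ℤ.- b [mod d ]
≈-neg {d} {b = b} (≈-by k refl) = ≈-by (ℤ.- k) (identity b k (+ d))
  where
  identity : ∀ b k d → ℤ.- (b ℤ.+ k ℤ.* d) ≡ ℤ.- b ℤ.+ (ℤ.- k) ℤ.* d
  identity = solve-∀

≈-weaken : ∀ {d e a b} → e ∣ d → a ≈ b [mod d ] → a ≈ b [mod e ]
≈-weaken {e = e} {b = b} (divides m refl) (≈-by k refl) =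
  ≈-by (k ℤ.* + m) (trans (cong (λ z → b ℤ.+ k ℤ.* z) (ℤP.pos-* m e)) (identity b k (+ m) (+ e)))
  where
  identity : ∀ b k m e → b ℤ.+ k ℤ.* (m ℤ.* e) ≡ b ℤ.+ (k ℤ.* m) ℤ.* e
  identity = solve-∀

≈-from-∣ : ∀ {d a b} → a ≡ b [mod d ] → a ≈ b [mod d ]
≈-from-∣ {a = a} {b} p with ℤ∣.∣ᵤ⇒∣ p
... | ℤ∣.divides k eq = ≈-by k (trans (identity a b) (cong (λ z → b ℤ.+ z) eq))
  where
  identity : ∀ a b → a ≡ b ℤ.+ (a ℤ.- b)
  identity = solve-∀

≈-to-∣ : ∀ {d a b} → a ≈ b [mod d ] → a ≡ b [mod d ]
≈-to-∣ {d} {b = b} (≈-by k refl) = ℤ∣.∣⇒∣ᵤ (ℤ∣.divides k (identity b k (+ d)))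
  where
  identity : ∀ b k d → (b ℤ.+ k ℤ.* d) ℤ.- b ≡ k ℤ.* d
  identity = solve-∀

%ℕ-≈ : ∀ X d .{{_ : NonZero d}} → + (X %ℕ d) ≈ X [mod d ]
%ℕ-≈ X d = ≈-sym (≈-by (X /ℕ d) (a≡a%ℕn+[a/ℕn]*n X d))

%-≈ : ∀ m d .{{_ : NonZero d}} → + (m % d) ≈ + m [mod d ]
%-≈ m d = %ℕ-≈ (+ m) d

≈-*ℕ : ∀ {d a b a′ b′} → + a ≈ + b [mod d ] → + a′ ≈ + b′ [mod d ] → + (a * a′) ≈ + (b * b′) [mod d ]
≈-*ℕ {d} {a} {b} {a′} {b′} p q = subst₂ (_≈_[mod d ]) (sym (ℤP.pos-* a a′)) (sym (ℤP.pos-* b b′)) (≈-* p q)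

no-positive-quotient : ∀ {d r r′ n} → r < d → + r ≡ + r′ ℤ.+ + suc n ℤ.* + d → ⊥
no-positive-quotient {d} {r} {r′} {n} r<d eq = ℕP.<⇒≱ r<d d≤r
  where
  r≡ : r ≡ r′ + suc n * d
  r≡ = ℤP.+-injective (trans eq
    (trans (cong (λ z → + r′ ℤ.+ z) (sym (ℤP.pos-* (suc n) d))) (sym (ℤP.pos-+ r′ (suc n * d)))))
  d≤r : d ≤ r
  d≤r = ℕP.≤-trans (ℕP.m≤m+n d (n * d)) (ℕP.≤-trans (ℕP.m≤n+m (suc n * d) r′) (ℕP.≤-reflexive (sym r≡)))

residue-unique : ∀ {d r r′} → r < d → r′ < d → + r ≈ + r′ [mod d ] → r ≡ r′
residue-unique {d} {r} {r′} _ _ (≈-by (+ zero) eq) =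
  ℤP.+-injective (trans eq (ℤP.+-identityʳ (+ r′)))
residue-unique {d} {r} {r′} r<d _ (≈-by (+ suc n) eq) = ⊥-elim (no-positive-quotient {r′ = r′} {n} r<d eq)
residue-unique {d} {r} {r′} _ r′<d (≈-by -[1+ n ] eq) =
  ⊥-elim (no-positive-quotient {r′ = r} {n} r′<d (isolate (+ r′) -[1+ n ] (+ d) eq))

_≈±_[mod_] : ℤ → ℤ → ℕ → Set
a ≈± b [mod d ] = a ≈ b [mod d ] ⊎ a ≈ ℤ.- b [mod d ]

infix 4 _≈±_[mod_]

≈-neg-sym : ∀ {d a b} → a ≈ ℤ.- b [mod d ] → b ≈ ℤ.- a [mod d ]
≈-neg-sym {d} {a} {b} p = ≈-sym (subst (λ z → ℤ.- a ≈ z [mod d ]) (ℤP.neg-involutive b) (≈-neg p))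

±-sym : ∀ {d a b} → a ≈± b [mod d ] → b ≈± a [mod d ]
±-sym (inj₁ p) = inj₁ (≈-sym p)
±-sym (inj₂ p) = inj₂ (≈-neg-sym p)

±-trans : ∀ {d a b c} → a ≈± b [mod d ] → b ≈± c [mod d ] → a ≈± c [mod d ]
±-trans (inj₁ p) (inj₁ q) = inj₁ (≈-trans p q)
±-trans (inj₁ p) (inj₂ q) = inj₂ (≈-trans p q)
±-trans (inj₂ p) (inj₁ q) = inj₂ (≈-trans p (≈-neg q))
±-trans {d} {c = c} (inj₂ p) (inj₂ q) =
  inj₁ (≈-trans p (subst (λ z → _ ≈ z [mod d ]) (ℤP.neg-involutive c) (≈-neg q)))

±-*ˡ : ∀ {d a b} c → a ≈± b [mod d ] → c ℤ.* a ≈± c ℤ.* b [mod d ]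
±-*ˡ c (inj₁ p) = inj₁ (≈-*ˡ c p)
±-*ˡ {d} {b = b} c (inj₂ p) = inj₂ (subst (λ z → _ ≈ z [mod d ]) (sym (ℤP.neg-distribʳ-* c b)) (≈-*ˡ c p))

sign-unique : ∀ {d} s s′ → 3 ≤ d → sign s ≈ sign s′ [mod d ] → s ≡ s′
sign-unique true  true  _ _ = refl
sign-unique false false _ _ = refl
sign-unique {d} true false 3≤d p with residue-unique {d} {2} {0} 3≤d (ℕP.<-trans (s≤s z≤n) 3≤d) (≈-+ p (≈-refl (+ 1)))
... | ()
sign-unique {d} false true 3≤d p with residue-unique {d} {2} {0} 3≤d (ℕP.<-trans (s≤s z≤n) 3≤d) (≈-+ (≈-sym p) (≈-refl (+ 1)))
... | ()

twice : ∀ x → 2 * x ≡ x + x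
twice x = cong (λ z → x + z) (ℕP.+-identityʳ x)

half<d : ∀ {d r} → 1 ≤ d → 2 * r ≤ d → r < d
half<d {r = zero}  1≤d _ = 1≤d
half<d {d} {suc r} _ h = ℕP.<-≤-trans (ℕP.m<m+n (suc r) (s≤s z≤n)) (subst (_≤ d) (twice (suc r)) h)

halves-sum≤ : ∀ {d r r′} → 2 * r ≤ d → 2 * r′ ≤ d → r + r′ ≤ d
halves-sum≤ {d} {r} {r′} h h′ = ℕP.*-cancelˡ-≤ 2 (begin
  2 * (r + r′)    ≡⟨ ℕP.*-distribˡ-+ 2 r r′ ⟩
  2 * r + 2 * r′  ≤⟨ ℕP.+-mono-≤ h h′ ⟩
  d + d           ≡⟨ twice d ⟨
  2 * d           ∎)
  where open ℕP.≤-Reasoning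

double≤sum⇒≤ : ∀ x y → 2 * x ≤ x + y → x ≤ y
double≤sum⇒≤ x y le = ℕP.+-cancelˡ-≤ x x y (subst (_≤ x + y) (twice x) le)

-- Two numbers in [0, d/2] that agree up to sign modulo d are equal: either they
-- are congruent residues, or r + r′ ≡ 0 (mod d) with r + r′ ∈ {0, d}.
half-residue-unique : ∀ {d r r′} → 1 ≤ d → 2 * r ≤ d → 2 * r′ ≤ d → + r ≈± + r′ [mod d ] → r ≡ r′
half-residue-unique 1≤d h h′ (inj₁ p) = residue-unique (half<d 1≤d h) (half<d 1≤d h′) p
half-residue-unique {d} {r} {r′} 1≤d h h′ (inj₂ p) with ℕP.m≤n⇒m<n∨m≡n (halves-sum≤ {d} {r} {r′} h h′)
... | inj₁ sum<d = trans (ℕP.m+n≡0⇒m≡0 r sum≡0) (sym (ℕP.m+n≡0⇒n≡0 r sum≡0))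
  where
  sum≈0 : + (r + r′) ≈ + 0 [mod d ]
  sum≈0 = subst₂ (_≈_[mod d ]) (sym (ℤP.pos-+ r r′)) (ℤP.+-inverseˡ (+ r′)) (≈-+ p (≈-refl (+ r′)))
  sum≡0 : r + r′ ≡ 0
  sum≡0 = residue-unique sum<d (ℕP.<-≤-trans (s≤s z≤n) 1≤d) sum≈0
... | inj₂ sum≡d = ℕP.≤-antisym
  (double≤sum⇒≤ r r′ (subst (2 * r ≤_) (sym sum≡d) h))
  (double≤sum⇒≤ r′ r (subst (2 * r′ ≤_) (trans (sym sum≡d) (ℕP.+-comm r r′)) h′))

-- For d ≥ 1, rep d m lies in [0, d/2] and is ≡ ±m (mod d): either r = m mod d
-- itself is small, or d - r is, and d - r ≡ -m.
rep-spec : ∀ {d} m → 1 ≤ d → 2 * rep d m ≤ d × + rep d m ≈± + m [mod d ]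
rep-spec {suc n} m _ with 2 * (m % suc n) <ᵇ suc n in small
... | true  = ℕP.<⇒≤ (ℕP.<ᵇ⇒< _ _ (subst T (sym small) _)) , inj₁ (%-≈ m (suc n))
... | false = reflected-small , inj₂ reflected≈
  where
  d = suc n
  r = m % d
  r≤d : r ≤ d
  r≤d = ℕP.<⇒≤ (m%n<n m d)
  d≤2r : d ≤ 2 * r
  d≤2r = ℕP.≮⇒≥ (λ lt → subst T small (ℕP.<⇒<ᵇ lt))
  d∸r≤r : d ∸ r ≤ r
  d∸r≤r = ℕP.m≤n+o⇒m∸n≤o d r (subst (d ≤_) (twice r) d≤2r)
  reflected-small : 2 * (d ∸ r) ≤ d
  reflected-small = begin
    2 * (d ∸ r)      ≡⟨ twice (d ∸ r) ⟩
    d ∸ r + (d ∸ r)  ≤⟨ ℕP.+-monoʳ-≤ (d ∸ r) d∸r≤r ⟩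
    d ∸ r + r        ≡⟨ ℕP.m∸n+n≡m r≤d ⟩
    d                ∎
    where open ℕP.≤-Reasoning
  identity : ∀ d r → d ℤ.- r ≡ ℤ.- r ℤ.+ + 1 ℤ.* d
  identity = solve-∀
  reflected≈ : + (d ∸ r) ≈ ℤ.- + m [mod d ]
  reflected≈ = ≈-trans
    (≈-by (+ 1) (trans (sym (trans (ℤP.m-n≡m⊖n d r) (ℤP.⊖-≥ r≤d))) (identity (+ d) (+ r))))
    (≈-neg (%-≈ m d))

rep-fixes : ∀ {d m j} → 1 ≤ d → 2 * j ≤ d → + m ≈± + j [mod d ] → rep d m ≡ j
rep-fixes {m = m} 1≤d hj p =
  half-residue-unique 1≤d (proj₁ (rep-spec m 1≤d)) hj (±-trans (proj₂ (rep-spec m 1≤d)) p)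

rep-invariant : ∀ {d m m′} → 1 ≤ d → + m ≈± + m′ [mod d ] → rep d m ≡ rep d m′
rep-invariant {m′ = m′} 1≤d p =
  rep-fixes 1≤d (proj₁ (rep-spec m′ 1≤d)) (±-trans p (±-sym (proj₂ (rep-spec m′ 1≤d))))

±-*ℕ : ∀ {d m m′} a → + m ≈± + m′ [mod d ] → + (a * m) ≈± + (a * m′) [mod d ]
±-*ℕ {d} {m} {m′} a p = subst₂ (_≈±_[mod d ]) (sym (ℤP.pos-* a m)) (sym (ℤP.pos-* a m′)) (±-*ˡ (+ a) p)

≈-cancel : ∀ {d j a b} → Coprime d j → + j ℤ.* a ≈ + j ℤ.* b [mod d ] → a ≈ b [mod d ]
≈-cancel {d} {j} {a} {b} cop p =
  ≈-from-∣ (coprime-divisor cop (subst (d ∣_) ∣ja-jb∣≡j∣a-b∣ (≈-to-∣ p)))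
  where
  identity : ∀ j a b → j ℤ.* a ℤ.- j ℤ.* b ≡ j ℤ.* (a ℤ.- b)
  identity = solve-∀
  ∣ja-jb∣≡j∣a-b∣ : ℤ.∣ + j ℤ.* a ℤ.- + j ℤ.* b ∣ ≡ j * ℤ.∣ a ℤ.- b ∣
  ∣ja-jb∣≡j∣a-b∣ = trans (cong ℤ.∣_∣ (identity (+ j) a b)) (ℤP.abs-* (+ j) (a ℤ.- b))

±-cancel : ∀ {d j a b} → Coprime d j → + j ℤ.* a ≈± + j ℤ.* b [mod d ] → a ≈± b [mod d ]
±-cancel cop (inj₁ p) = inj₁ (≈-cancel cop p)
±-cancel {d} {j} {b = b} cop (inj₂ p) =
  inj₂ (≈-cancel cop (subst (λ z → _ ≈ z [mod d ]) (ℤP.neg-distribʳ-* (+ j) b) p))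

±1-scale : ∀ {d g} m → + g ≈± + 1 [mod d ] → + (g * m) ≈± + m [mod d ]
±1-scale {d} {g} m p = subst₂ (_≈±_[mod d ])
  (trans (sym (ℤP.pos-* m g)) (cong +_ (ℕP.*-comm m g))) (ℤP.*-identityʳ (+ m)) (±-*ˡ (+ m) p)

±1-unscale : ∀ {d g j} → Coprime d j → + (g * j) ≈± + j [mod d ] → + g ≈± + 1 [mod d ]
±1-unscale {d} {g} {j} cop p = ±-cancel cop (subst₂ (_≈±_[mod d ])
  (trans (cong +_ (ℕP.*-comm g j)) (ℤP.pos-* j g)) (sym (ℤP.*-identityʳ (+ j))) p)

sign⇒±1 : ∀ {d a} s → a ≈ sign s [mod d ] → a ≈± + 1 [mod d ]
sign⇒±1 true  p = inj₁ p
sign⇒±1 false p = inj₂ p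

signBit : ℕ → ℕ → Bool
signBit zero    g = false
signBit (suc n) g = g % suc n ≡ᵇ 1

-1≈pred : ∀ n → -[1+ 0 ] ≈ + n [mod suc n ]
-1≈pred n = ≈-by -[1+ 0 ] (trans (identity (+ n)) (cong (λ z → + n ℤ.+ -[1+ 0 ] ℤ.* z) (sym (ℤP.pos-+ 1 n))))
  where
  identity : ∀ m → ℤ.- + 1 ≡ m ℤ.+ ℤ.- + 1 ℤ.* (+ 1 ℤ.+ m)
  identity = solve-∀

-- For d ≥ 3, signBit recovers ε from g ≡ ε (mod d): the residue of g is 1 or d - 1.
signBit-spec : ∀ {d g} s → 3 ≤ d → + g ≈ sign s [mod d ] → signBit d g ≡ s
signBit-spec {suc (suc (suc n))} {g} true (s≤s (s≤s (s≤s _))) p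
  rewrite residue-unique {r′ = 1} (m%n<n g (3 + n)) (s≤s (s≤s z≤n)) (≈-trans (%-≈ g _) p) = refl
signBit-spec {suc (suc (suc n))} {g} false (s≤s (s≤s (s≤s _))) p
  rewrite residue-unique (m%n<n g (3 + n)) ℕP.≤-refl (≈-trans (%-≈ g _) (≈-trans p (-1≈pred (2 + n)))) = refl

±1⇒sign : ∀ {d g} → 3 ≤ d → + g ≈± + 1 [mod d ] → + g ≈ sign (signBit d g) [mod d ]
±1⇒sign {d} {g} 3≤d (inj₁ p) = subst (λ s → + g ≈ sign s [mod d ]) (sym (signBit-spec true 3≤d p)) p
±1⇒sign {d} {g} 3≤d (inj₂ p) = subst (λ s → + g ≈ sign s [mod d ]) (sym (signBit-spec false 3≤d p)) p

lookup-ext : ∀ {A : Set} {n} {u v : Vec A n} → (∀ i → lookup u i ≡ lookup v i) → u ≡ v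
lookup-ext {u = u} {v} h =
  trans (sym (VecP.tabulate∘lookup u)) (trans (VecP.tabulate-cong h) (VecP.tabulate∘lookup v))

lookup-act : ∀ {q} (d : Vec ℕ q) a x i → lookup (act d a x) i ≡ rep (lookup d i) (a * lookup x i)
lookup-act d a x i = VecP.lookup-zipWith (λ di xi → actJ di a xi) i d x

dᵢ∣N : ∀ {q} (d : Vec ℕ q) i → lookup d i ∣ lcmAll d
dᵢ∣N (x ∷ d) zero    = m∣lcm[m,n] x _
dᵢ∣N (x ∷ d) (suc i) = ℕ∣.∣-trans (dᵢ∣N d i) (n∣lcm[m,n] x _)

N-least : ∀ {q} (d : Vec ℕ q) {t} → (∀ i → lookup d i ∣ t) → lcmAll d ∣ t
N-least []      h = ℕ∣.1∣ _
N-least (x ∷ d) h = lcm-least (h zero) (N-least d (λ i → h (suc i)))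

≈-lcmAll : ∀ {q} (d : Vec ℕ q) {a b} → (∀ i → a ≈ b [mod lookup d i ]) → a ≈ b [mod lcmAll d ]
≈-lcmAll d a≈b = ≈-from-∣ (N-least d (λ i → ≈-to-∣ (a≈b i)))

-- N ≥ 1 when all moduli are positive, since gcd(m,n)·lcm(m,n) = m·n.
lcm-pos : ∀ {m n} → 1 ≤ m → 1 ≤ n → 1 ≤ lcm m n
lcm-pos {m} {n} hm hn = ℕP.n≢0⇒n>0 λ lcm≡0 → ℕP.<⇒≢ (ℕP.*-mono-≤ hm hn) (sym (begin
  m * n                ≡⟨ gcd*lcm m n ⟨
  gcd m n * lcm m n    ≡⟨ cong (gcd m n *_) lcm≡0 ⟩
  gcd m n * 0          ≡⟨ ℕP.*-zeroʳ (gcd m n) ⟩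
  0                    ∎))
  where open ≡-Reasoning

N-pos : ∀ {q} (d : Vec ℕ q) → (∀ i → 1 ≤ lookup d i) → 1 ≤ lcmAll d
N-pos []      _ = ℕP.≤-refl
N-pos (x ∷ d) h = lcm-pos (h zero) (N-pos d (λ i → h (suc i)))

module Action {q} (d : Vec ℕ q) (d-pos : ∀ i → 1 ≤ lookup d i) where

  -- (a·(b·x)) = (ab)·x, since rep (b xᵢ) ≡ ±b xᵢ.
  act-∘ : ∀ a b x → act d a (act d b x) ≡ act d (a * b) x
  act-∘ a b x = lookup-ext λ i → begin
    lookup (act d a (act d b x)) i               ≡⟨ lookup-act d a (act d b x) i ⟩
    rep (lookup d i) (a * lookup (act d b x) i)  ≡⟨ cong (λ z → rep (lookup d i) (a * z)) (lookup-act d b x i) ⟩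
    rep (lookup d i) (a * rep (lookup d i) (b * lookup x i))
      ≡⟨ rep-invariant (d-pos i) (±-*ℕ a (proj₂ (rep-spec (b * lookup x i) (d-pos i)))) ⟩
    rep (lookup d i) (a * (b * lookup x i))      ≡⟨ cong (rep (lookup d i)) (ℕP.*-assoc a b (lookup x i)) ⟨
    rep (lookup d i) (a * b * lookup x i)        ≡⟨ lookup-act d (a * b) x i ⟨
    lookup (act d (a * b) x) i                   ∎
    where open ≡-Reasoning

  act-mod-N : ∀ {a a′} x → + a ≈ + a′ [mod lcmAll d ] → act d a x ≡ act d a′ x
  act-mod-N {a} {a′} x p = lookup-ext λ i → begin
    lookup (act d a x) i              ≡⟨ lookup-act d a x i ⟩
    rep (lookup d i) (a * lookup x i)
      ≡⟨ rep-invariant (d-pos i) (inj₁ (≈-*ℕ (≈-weaken (dᵢ∣N d i) p) (≈-refl (+ lookup x i)))) ⟩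
    rep (lookup d i) (a′ * lookup x i) ≡⟨ lookup-act d a′ x i ⟨
    lookup (act d a′ x) i             ∎
    where open ≡-Reasoning

  act-trivial : ∀ g x → InJs d x → (∀ i → + g ≈± + 1 [mod lookup d i ]) → act d g x ≡ x
  act-trivial g x x∈J g≈±1 = lookup-ext λ i → trans (lookup-act d g x i)
    (rep-fixes (d-pos i) (ℕP.<⇒≤ (proj₁ (x∈J i))) (±1-scale (lookup x i) (g≈±1 i)))

  -- Conversely, if g fixes a unit j modulo dᵢ then g ≡ ±1: cancel j from g j ≡ ±j.
  fixes-unit⇒±1 : ∀ {g j} i → gcd j (lookup d i) ≡ 1 → rep (lookup d i) (g * j) ≡ j → + g ≈± + 1 [mod lookup d i ]
  fixes-unit⇒±1 {g} {j} i cop fixed = ±1-unscale (Coprime.sym (gcd≡1⇒coprime {j} {lookup d i} cop))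
    (subst (λ z → + (g * j) ≈± + z [mod lookup d i ]) fixed (±-sym (proj₂ (rep-spec (g * j) (d-pos i)))))

module _ {A : Set} where

  same-members⇒same-length : ∀ {xs ys : List A} → Unique xs → Unique ys →
    (∀ a → a ∈ xs → a ∈ ys) → (∀ a → a ∈ ys → a ∈ xs) → length xs ≡ length ys
  same-members⇒same-length u v to from =
    ↭-length (∼bag⇒↭ (unique∧set⇒bag u v (mk⇔ (to _) (from _))))

  HasSize-unique : ∀ {P : A → Set} {m n} → HasSize P m → HasSize P n → m ≡ n
  HasSize-unique (xs , u , xs≗P , refl) (ys , v , ys≗P , refl) = same-members⇒same-length u v
    (λ a a∈xs → proj₂ (ys≗P a) (proj₁ (xs≗P a) a∈xs))
    (λ a a∈ys → proj₂ (xs≗P a) (proj₁ (ys≗P a) a∈ys))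

module _ {A B : Set} where

  map-unique : ∀ (f : A → B) {l} → (∀ {a b} → a ∈ l → b ∈ l → f a ≡ f b → a ≡ b) → Unique l → Unique (map f l)
  map-unique f {[]}    _   []          = []
  map-unique f {x ∷ l} inj (x∉l ∷ u) =
    AllP.map⁺ (All.tabulate (λ y∈l fx≡fy → All.lookup x∉l y∈l (inj (here refl) (there y∈l) fx≡fy)))
    ∷ map-unique f (λ a∈l b∈l → inj (there a∈l) (there b∈l)) u

  HasSize-bijection : ∀ {P : A → Set} {Q : B → Set} {n} (f : A → B) →
    (∀ {a} → P a → Q (f a)) →
    (∀ {a b} → P a → P b → f a ≡ f b → a ≡ b) →
    (∀ {b} → Q b → ∃ λ a → P a × f a ≡ b) →
    HasSize P n → HasSize Q n
  HasSize-bijection {P = P} {Q} f into injective onto (l , u , l≗P , len) =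
    map f l , map-unique f (λ a∈l b∈l → injective (member a∈l) (member b∈l)) u , l′≗Q ,
    trans (ListP.length-map f l) len
    where
    member : ∀ {a} → a ∈ l → P a
    member {a} = proj₁ (l≗P a)
    l′≗Q : ∀ b → (b ∈ map f l → Q b) × (Q b → b ∈ map f l)
    l′≗Q b = (λ b∈ → let (a , a∈l , b≡fa) = ∈-map⁻ f b∈ in subst Q (sym b≡fa) (into (member a∈l)))
           , (λ Qb → let (a , Pa , fa≡b) = onto Qb in subst (_∈ map f l) fa≡b (∈-map⁺ f (proj₂ (l≗P a) Pa)))

module Fibres {A B : Set} (_≟_ : DecidableEquality B) (φ : A → B) where

  fibre : B → List A → List A
  fibre y = filter (λ a → φ a ≟ y)

  hits : A → B → ℕ
  hits a y = if does (φ a ≟ y) then 1 else 0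

  length-fibre-∷ : ∀ y a l → length (fibre y (a ∷ l)) ≡ hits a y + length (fibre y l)
  length-fibre-∷ y a l with φ a ≟ y
  ... | yes _ = refl
  ... | no  _ = refl

  sum-hits-absent : ∀ a ys → All (φ a ≢_) ys → sum (map (hits a) ys) ≡ 0
  sum-hits-absent a []       _              = refl
  sum-hits-absent a (y ∷ ys) (φa≢y All.∷ rest) with φ a ≟ y
  ... | yes φa≡y = ⊥-elim (φa≢y φa≡y)
  ... | no  _    = sum-hits-absent a ys rest

  sum-hits : ∀ a ys → Unique ys → φ a ∈ ys → sum (map (hits a) ys) ≡ 1
  sum-hits a (y ∷ ys) (y∉ys ∷ _) (here refl) with φ a ≟ y
  ... | yes _     = cong suc (sum-hits-absent a ys y∉ys)
  ... | no  φa≢y  = ⊥-elim (φa≢y refl)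
  sum-hits a (y ∷ ys) (y∉ys ∷ u) (there φa∈ys) with φ a ≟ y
  ... | yes refl  = ⊥-elim (All.lookup y∉ys φa∈ys refl)
  ... | no  _     = sum-hits a ys u φa∈ys

  sum-map-+ : ∀ (f g : B → ℕ) ys → sum (map (λ y → f y + g y) ys) ≡ sum (map f ys) + sum (map g ys)
  sum-map-+ f g []       = refl
  sum-map-+ f g (y ∷ ys) = trans (cong (λ z → f y + g y + z) (sum-map-+ f g ys))
    (interchange (f y) (g y) (sum (map f ys)) (sum (map g ys)))
    where
    interchange : ∀ a b c d → a + b + (c + d) ≡ a + c + (b + d)
    interchange = ℕ-Ring.solve-∀

  sum-fibres : ∀ ys → Unique ys → ∀ l → (∀ {a} → a ∈ l → φ a ∈ ys) →
    sum (map (λ y → length (fibre y l)) ys) ≡ length l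
  sum-fibres ys u []      _    = sum-zero ys
    where
    sum-zero : ∀ zs → sum (map (λ y → length (fibre y [])) zs) ≡ 0
    sum-zero []       = refl
    sum-zero (_ ∷ zs) = sum-zero zs
  sum-fibres ys u (a ∷ l) into = begin
    sum (map (λ y → length (fibre y (a ∷ l))) ys)
      ≡⟨ cong sum (ListP.map-cong (λ y → length-fibre-∷ y a l) ys) ⟩
    sum (map (λ y → hits a y + length (fibre y l)) ys)
      ≡⟨ sum-map-+ (hits a) (λ y → length (fibre y l)) ys ⟩
    sum (map (hits a) ys) + sum (map (λ y → length (fibre y l)) ys)
      ≡⟨ cong₂ _+_ (sum-hits a ys u (into (here refl))) (sum-fibres ys u l (λ a∈l → into (there a∈l))) ⟩
    suc (length l) ∎
    where open ≡-Reasoning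

  sum-const : ∀ (f : B → ℕ) {n} ys → (∀ {y} → y ∈ ys → f y ≡ n) → sum (map f ys) ≡ length ys * n
  sum-const f []       _     = refl
  sum-const f (y ∷ ys) f≡n = cong₂ _+_ (f≡n (here refl)) (sum-const f ys (λ y∈ys → f≡n (there y∈ys)))

  count-by-fibres : ∀ {P : A → Set} {Q : B → Set} {nP nQ n} → HasSize P nP → HasSize Q nQ →
    (∀ {a} → P a → Q (φ a)) → (∀ {y} → Q y → HasSize (λ a → P a × φ a ≡ y) n) → nP ≡ nQ * n
  count-by-fibres {P = P} {n = n} (lP , uP , lP≗P , refl) (lQ , uQ , lQ≗Q , refl) into fibre-size = begin
    length lP
      ≡⟨ sum-fibres lQ uQ lP (λ a∈lP → proj₂ (lQ≗Q _) (into (proj₁ (lP≗P _) a∈lP))) ⟨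
    sum (map (λ y → length (fibre y lP)) lQ)
      ≡⟨ sum-const (λ y → length (fibre y lP)) lQ fibre-length ⟩
    length lQ * n ∎
    where
    open ≡-Reasoning
    fibre-length : ∀ {y} → y ∈ lQ → length (fibre y lP) ≡ n
    fibre-length {y} y∈lQ = HasSize-unique
      (fibre y lP , UniqueP.filter⁺ (λ a → φ a ≟ y) uP ,
        (λ a → (λ a∈ → let (a∈lP , φa≡y) = ∈-filter⁻ (λ a → φ a ≟ y) a∈ in proj₁ (lP≗P a) a∈lP , φa≡y)
             , (λ (Pa , φa≡y) → ∈-filter⁺ (λ a → φ a ≟ y) (proj₂ (lP≗P a) Pa) φa≡y)) , refl)
      (fibre-size (proj₁ (lQ≗Q y) y∈lQ))

bezout : ∀ a b → ∃ λ x → ∃ λ y → x ℤ.* + a ℤ.+ y ℤ.* + b ≡ + gcd a b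
bezout a b with Bézout.identity (gcd-GCD a b)
... | Bézout.+- x y eq = + x , ℤ.- + y ,
  trans (cong (λ z → z ℤ.+ ℤ.- + y ℤ.* + b) (sym (lift eq))) (identity (+ gcd a b) (+ y) (+ b))
  where
  identity : ∀ g y b → (g ℤ.+ y ℤ.* b) ℤ.+ ℤ.- y ℤ.* b ≡ g
  identity = solve-∀
  lift : gcd a b + y * b ≡ x * a → + gcd a b ℤ.+ + y ℤ.* + b ≡ + x ℤ.* + a
  lift e = trans (sym (trans (ℤP.pos-+ _ (y * b)) (cong (λ z → + gcd a b ℤ.+ z) (ℤP.pos-* y b))))
                 (trans (cong +_ e) (ℤP.pos-* x a))
... | Bézout.-+ x y eq = ℤ.- + x , + y ,
  trans (cong (λ z → ℤ.- + x ℤ.* + a ℤ.+ z) (sym (lift eq))) (identity (+ gcd a b) (+ x) (+ a))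
  where
  identity : ∀ g x a → ℤ.- x ℤ.* a ℤ.+ (g ℤ.+ x ℤ.* a) ≡ g
  identity = solve-∀
  lift : gcd a b + x * a ≡ y * b → + gcd a b ℤ.+ + x ℤ.* + a ≡ + y ℤ.* + b
  lift e = trans (sym (trans (ℤP.pos-+ _ (x * a)) (cong (λ z → + gcd a b ℤ.+ z) (ℤP.pos-* x a))))
                 (trans (cong +_ e) (ℤP.pos-* y b))

combination⇒≈ : ∀ {x a y b c} → x ℤ.* a ℤ.+ y ℤ.* + b ≡ c → x ℤ.* a ≈ c [mod b ]
combination⇒≈ {x} {a} {y} {b} refl = ≈-by (ℤ.- y) (identity (x ℤ.* a) y (+ b))
  where
  identity : ∀ xa y b → xa ≡ (xa ℤ.+ y ℤ.* b) ℤ.+ ℤ.- y ℤ.* b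
  identity = solve-∀

inverse : ∀ {g N} .{{_ : NonZero N}} → gcd g N ≡ 1 → ∃ λ u → + (u * g) ≈ + 1 [mod N ]
inverse {g} {N} cop with bezout g N
... | x , y , eq = x %ℕ N ,
  subst (λ z → z ≈ + 1 [mod N ]) (sym (ℤP.pos-* (x %ℕ N) g))
    (≈-trans (≈-*ʳ (+ g) (%ℕ-≈ x N)) (combination⇒≈ {x} {+ g} {y} (trans eq (cong +_ cop))))

≈-coprime : ∀ {N a b} → + a ≈ + b [mod N ] → Coprime b N → Coprime a N
≈-coprime {N} {a} {b} (≈-by k eq) cop {i} (i∣a , i∣N) = cop (ℤ∣.∣⇒∣ᵤ i∣b , i∣N)
  where
  i∣kN : + i ℤ∣.∣ k ℤ.* + N
  i∣kN = ℤ∣.∣n⇒∣m*n k (ℤ∣.∣ᵤ⇒∣ i∣N)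
  i∣b : + i ℤ∣.∣ + b
  i∣b = ℤ∣.∣m+n∣n⇒∣m (subst (+ i ℤ∣.∣_) eq (ℤ∣.∣ᵤ⇒∣ i∣a)) i∣kN

invertible⇒coprime : ∀ {u g N} → + (u * g) ≈ + 1 [mod N ] → Coprime u N
invertible⇒coprime {u} {g} p (i∣u , i∣N) =
  ≈-coprime p (λ (i∣1 , _) → ℕ∣.∣1⇒≡1 i∣1) (ℕ∣.∣-trans i∣u (ℕ∣.m∣m*n g) , i∣N)

coprime-* : ∀ {a b N} → Coprime a N → Coprime b N → Coprime (a * b) N
coprime-* {a} {b} {N} ca cb {i} (i∣ab , i∣N) = cb (coprime-divisor i⊥a i∣ab , i∣N)
  where
  i⊥a : Coprime i a
  i⊥a (j∣i , j∣a) = ca (j∣a , ℕ∣.∣-trans j∣i i∣N)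

-- InIdeal a b t: t lies in the ideal aℤ + bℤ, written as t ≡ r·a (mod b).
InIdeal : ℕ → ℕ → ℤ → Set
InIdeal a b t = ∃ λ r → t ≈ r ℤ.* + a [mod b ]

ideal-* : ∀ {a b t} c → InIdeal a b t → InIdeal a b (c ℤ.* t)
ideal-* {a} {b} c (r , t≈ra) = c ℤ.* r , subst (λ z → _ ≈ z [mod b ]) (sym (ℤP.*-assoc c r (+ a))) (≈-*ˡ c t≈ra)

ideal-+-multiple : ∀ {a b t} k → InIdeal a b t → InIdeal a b (t ℤ.+ k ℤ.* + a)
ideal-+-multiple {a} {b} k (r , t≈ra) = r ℤ.+ k ,
  subst (λ z → _ ≈ z [mod b ]) (sym (ℤP.*-distribʳ-+ (+ a) r k)) (≈-+ t≈ra (≈-refl (k ℤ.* + a)))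

ideal-neg : ∀ {a b t} → InIdeal a b t → InIdeal a b (ℤ.- t)
ideal-neg {a} {b} (r , t≈ra) = ℤ.- r , subst (λ z → _ ≈ z [mod b ]) (ℤP.neg-distribˡ-* r (+ a)) (≈-neg t≈ra)

divisor∈ideal : ∀ {a b n} → gcd a b ∣ n → InIdeal a b (+ n) × InIdeal a b (ℤ.- + n)
divisor∈ideal {a} {b} {n} (divides c refl) = n∈ , ideal-neg n∈
  where
  gcd∈ : InIdeal a b (+ gcd a b)
  gcd∈ = let (x , y , eq) = bezout a b in x , ≈-sym (combination⇒≈ {x} {+ a} {y} eq)
  n∈ : InIdeal a b (+ (c * gcd a b))
  n∈ = subst (InIdeal a b) (sym (ℤP.pos-* c (gcd a b))) (ideal-* (+ c) gcd∈)

record Cofactors (b L : ℕ) : Set where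
  field
    g b′ L′ : ℕ
    α β     : ℤ
    b≡      : + b ≡ + b′ ℤ.* + g
    L≡      : + L ≡ + L′ ℤ.* + g
    lcm≡    : + lcm b L ≡ + b′ ℤ.* + L′ ℤ.* + g
    bezout′ : α ℤ.* + b′ ℤ.+ β ℤ.* + L′ ≡ + 1

cofactors : ∀ b L → 1 ≤ b → Cofactors b L
cofactors b L 1≤b with gcd b L in g≡ | gcd[m,n]∣m b L | gcd[m,n]∣n b L
... | zero | _ | _ = ⊥-elim (ℕP.<⇒≢ 1≤b (sym (gcd[m,n]≡0⇒m≡0 g≡)))
... | suc g₀ | divides b′ refl | divides L′ refl = record
  { g = g ; b′ = b′ ; L′ = L′ ; α = x ; β = y
  ; b≡ = ℤP.pos-* b′ g ; L≡ = ℤP.pos-* L′ g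
  ; lcm≡ = trans (cong +_ lcm-eq) (trans (ℤP.pos-* (b′ * L′) g) (cong (ℤ._* + g) (ℤP.pos-* b′ L′)))
  ; bezout′ = ℤP.*-cancelʳ-≡ _ _ (+ g) (trans (identity x y (+ b′) (+ L′) (+ g)) (trans lifted (sym (ℤP.*-identityˡ (+ g)))))
  }
  where
  g = suc g₀
  x = proj₁ (bezout (b′ * g) (L′ * g))
  y = proj₁ (proj₂ (bezout (b′ * g) (L′ * g)))
  identity : ∀ x y b′ L′ g → (x ℤ.* b′ ℤ.+ y ℤ.* L′) ℤ.* g ≡ x ℤ.* (b′ ℤ.* g) ℤ.+ y ℤ.* (L′ ℤ.* g)
  identity = solve-∀
  lifted : x ℤ.* (+ b′ ℤ.* + g) ℤ.+ y ℤ.* (+ L′ ℤ.* + g) ≡ + g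
  lifted = trans (cong₂ (λ u v → x ℤ.* u ℤ.+ y ℤ.* v) (sym (ℤP.pos-* b′ g)) (sym (ℤP.pos-* L′ g)))
                 (trans (proj₂ (proj₂ (bezout (b′ * g) (L′ * g)))) (cong +_ g≡))
  lcm-eq : lcm (b′ * g) (L′ * g) ≡ b′ * L′ * g
  lcm-eq = ℕP.*-cancelˡ-≡ _ _ g (begin
    g * lcm (b′ * g) (L′ * g)                     ≡⟨ cong (_* lcm (b′ * g) (L′ * g)) g≡ ⟨
    gcd (b′ * g) (L′ * g) * lcm (b′ * g) (L′ * g) ≡⟨ gcd*lcm (b′ * g) (L′ * g) ⟩
    b′ * g * (L′ * g)                             ≡⟨ rearrange b′ L′ g ⟩
    g * (b′ * L′ * g)                             ∎)
    where
    open ≡-Reasoning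
    rearrange : ∀ b L g → b * g * (L * g) ≡ g * (b * L * g)
    rearrange = ℕ-Ring.solve-∀

-- (bℤ + aℤ) ∩ (Lℤ + aℤ) ⊆ lcm(b, L)ℤ + aℤ: if t ≡ r·b and t ≡ s·L (mod a), then
-- t = αb′t + βL′t ≡ αb′·sL′g + βL′·rb′g = (αs + βr)·b′L′g (mod a).
ideal-lcm : ∀ {b L a t} → 1 ≤ b → InIdeal b a t → InIdeal L a t → InIdeal (lcm b L) a t
ideal-lcm {b} {L} {a} {t} 1≤b (r , t≈rb) (s , t≈sL) = α ℤ.* s ℤ.+ β ℤ.* r , t≈
  where
  open Cofactors (cofactors b L 1≤b)
  distrib : ∀ α b β L t → (α ℤ.* b ℤ.+ β ℤ.* L) ℤ.* t ≡ α ℤ.* b ℤ.* t ℤ.+ β ℤ.* L ℤ.* t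
  distrib = solve-∀
  regroup : ∀ α b β L s r g → α ℤ.* b ℤ.* (s ℤ.* (L ℤ.* g)) ℤ.+ β ℤ.* L ℤ.* (r ℤ.* (b ℤ.* g))
                              ≡ (α ℤ.* s ℤ.+ β ℤ.* r) ℤ.* (b ℤ.* L ℤ.* g)
  regroup = solve-∀
  split-t : t ≡ α ℤ.* + b′ ℤ.* t ℤ.+ β ℤ.* + L′ ℤ.* t
  split-t = trans (sym (ℤP.*-identityˡ t)) (trans (cong (ℤ._* t) (sym bezout′)) (distrib α (+ b′) β (+ L′) t))
  combine : α ℤ.* + b′ ℤ.* (s ℤ.* + L) ℤ.+ β ℤ.* + L′ ℤ.* (r ℤ.* + b) ≡ (α ℤ.* s ℤ.+ β ℤ.* r) ℤ.* + lcm b L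
  combine = trans (cong₂ (λ u v → α ℤ.* + b′ ℤ.* (s ℤ.* u) ℤ.+ β ℤ.* + L′ ℤ.* (r ℤ.* v)) L≡ b≡)
                  (trans (regroup α (+ b′) β (+ L′) s r (+ g)) (cong ((α ℤ.* s ℤ.+ β ℤ.* r) ℤ.*_) (sym lcm≡)))
  t≈ : t ≈ (α ℤ.* s ℤ.+ β ℤ.* r) ℤ.* + lcm b L [mod a ]
  t≈ = subst₂ (_≈_[mod a ]) (sym split-t) combine (≈-+ (≈-*ˡ (α ℤ.* + b′) t≈sL) (≈-*ˡ (β ℤ.* + L′) t≈rb))

ideal-lcmAll : ∀ {q} (ds : Vec ℕ q) {a t} → (∀ i → 1 ≤ lookup ds i) →
  (∀ i → InIdeal (lookup ds i) a t) → InIdeal (lcmAll ds) a t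
ideal-lcmAll []       {t = t} _ _ = t , ≈-reflexive (sym (ℤP.*-identityʳ t))
ideal-lcmAll (b ∷ ds) pos t∈ =
  ideal-lcm (pos zero) (t∈ zero) (ideal-lcmAll ds (λ i → pos (suc i)) (λ i → t∈ (suc i)))

-- Induction: solve the tail by X′; then X′ + tL (L the lcm of the tail) also
-- meets the head target once v₀ - X′ ∈ Lℤ + d₀ℤ, which follows from ideal-lcmAll.
crt : ∀ {q} (ds : Vec ℕ q) → (∀ i → 1 ≤ lookup ds i) → (v : Fin q → ℤ) →
  (∀ i j → InIdeal (lookup ds i) (lookup ds j) (v j ℤ.- v i)) →
  ∃ λ X → ∀ i → X ≈ v i [mod lookup ds i ]
crt []       _   v _      = + 0 , λ ()
crt (a ∷ ds) pos v compat with crt ds (λ i → pos (suc i)) (λ i → v (suc i)) (λ i j → compat (suc i) (suc j))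
... | X′ , X′≈v = X′ ℤ.+ t ℤ.* + lcmAll ds , solves
  where
  gap∈ : ∀ i → InIdeal (lookup ds i) a (v zero ℤ.- X′)
  gap∈ i with X′≈v i
  ... | ≈-by k X′≡ = subst (InIdeal (lookup ds i) a)
      (trans (identity (v zero) (v (suc i)) k (+ lookup ds i)) (cong (λ z → v zero ℤ.- z) (sym X′≡)))
      (ideal-+-multiple (ℤ.- k) (compat (suc i) zero))
    where
    identity : ∀ v₀ vᵢ k d → (v₀ ℤ.- vᵢ) ℤ.+ ℤ.- k ℤ.* d ≡ v₀ ℤ.- (vᵢ ℤ.+ k ℤ.* d)
    identity = solve-∀
  t = proj₁ (ideal-lcmAll ds (λ i → pos (suc i)) gap∈)
  solves : ∀ i → X′ ℤ.+ t ℤ.* + lcmAll ds ≈ v i [mod lookup (a ∷ ds) i ]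
  solves zero    = subst (λ z → X′ ℤ.+ t ℤ.* + lcmAll ds ≈ z [mod a ]) (identity X′ (v zero))
    (≈-+ (≈-refl X′) (≈-sym (proj₂ (ideal-lcmAll ds (λ i → pos (suc i)) gap∈))))
    where
    identity : ∀ X v → X ℤ.+ (v ℤ.- X) ≡ v
    identity = solve-∀
  solves (suc i) = ≈-trans (≈-weaken (dᵢ∣N ds i) (≈-by t refl)) (X′≈v i)

small-gcd∣2 : ∀ {a b} → 1 ≤ a → gcd a b < 3 → gcd a b ∣ 2
small-gcd∣2 {a} {b} 1≤a small with gcd a b in g≡
... | 0 = ⊥-elim (ℕP.<⇒≢ 1≤a (sym (gcd[m,n]≡0⇒m≡0 g≡)))
... | 1 = ℕ∣.1∣ 2
... | 2 = ℕ∣.∣-refl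
... | suc (suc (suc _)) = ⊥-elim (ℕP.<⇒≱ small (s≤s (s≤s (s≤s z≤n))))

-- Two signs differ by 0 or ±2, so their difference lies in aℤ + bℤ whenever gcd(a,b) ∣ 2.
sign-gap∈ideal : ∀ a b s s′ → (s ≢ s′ → gcd a b ∣ 2) → InIdeal a b (sign s′ ℤ.- sign s)
sign-gap∈ideal a b true  true  _     = + 0 , ≈-refl (+ 0)
sign-gap∈ideal a b false false _     = + 0 , ≈-refl (+ 0)
sign-gap∈ideal a b true  false gcd∣2 = proj₂ (divisor∈ideal (gcd∣2 λ ()))
sign-gap∈ideal a b false true  gcd∣2 = proj₁ (divisor∈ideal (gcd∣2 λ ()))

allSigns : ∀ c → List (Vec Bool c)
allSigns zero    = [] ∷ []
allSigns (suc c) = map (true ∷_) (allSigns c) ++ map (false ∷_) (allSigns c)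

allSigns-size : ∀ c → HasSize (λ (_ : Vec Bool c) → ⊤) (2 ^ c)
allSigns-size c = allSigns c , unique c , (λ v → (λ _ → tt) , (λ _ → complete v)) , length-allSigns c
  where
  unique : ∀ c → Unique (allSigns c)
  unique zero    = All.[] ∷ []
  unique (suc c) = UniqueP.++⁺ (UniqueP.map⁺ VecP.∷-injectiveʳ (unique c)) (UniqueP.map⁺ VecP.∷-injectiveʳ (unique c))
    λ (v∈t , v∈f) → heads-differ (∈-map⁻ (true ∷_) v∈t) (∈-map⁻ (false ∷_) v∈f)
    where
    heads-differ : ∀ {v : Vec Bool (suc c)} →
      (∃ λ u → u ∈ allSigns c × v ≡ true ∷ u) → (∃ λ w → w ∈ allSigns c × v ≡ false ∷ w) → ⊥
    heads-differ (_ , _ , refl) (_ , _ , ())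
  complete : ∀ {c} (v : Vec Bool c) → v ∈ allSigns c
  complete []          = here refl
  complete (true ∷ v)  = ∈-++⁺ˡ (∈-map⁺ (true ∷_) (complete v))
  complete (false ∷ v) = ∈-++⁺ʳ (map (true ∷_) (allSigns _)) (∈-map⁺ (false ∷_) (complete v))
  length-allSigns : ∀ c → length (allSigns c) ≡ 2 ^ c
  length-allSigns zero    = refl
  length-allSigns (suc c) = begin
    length (map (true ∷_) (allSigns c) ++ map (false ∷_) (allSigns c))
      ≡⟨ ListP.length-++ (map (true ∷_) (allSigns c)) ⟩
    length (map (true ∷_) (allSigns c)) + length (map (false ∷_) (allSigns c))
      ≡⟨ cong₂ _+_ (ListP.length-map (true ∷_) (allSigns c)) (ListP.length-map (false ∷_) (allSigns c)) ⟩
    length (allSigns c) + length (allSigns c)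
      ≡⟨ cong₂ _+_ (length-allSigns c) (length-allSigns c) ⟩
    2 ^ c + 2 ^ c
      ≡⟨ twice (2 ^ c) ⟨
    2 ^ suc c ∎
    where open ≡-Reasoning

module Lemma {q} (d : Vec ℕ q) (d≥3 : ∀ i → 3 ≤ lookup d i) where

  d-pos : ∀ i → 1 ≤ lookup d i
  d-pos i = ℕP.≤-trans (s≤s z≤n) (d≥3 i)

  open Action d d-pos

  N : ℕ
  N = lcmAll d

  instance
    N-nonZero : NonZero N
    N-nonZero = >-nonZero (N-pos d d-pos)

  H-acts-trivially : (g : ℕ) → InH d g → (x : Vec ℕ q) → InJs d x → act d g x ≡ x
  H-acts-trivially g (_ , ε , g≡ε) x x∈J =
    act-trivial g x x∈J (λ i → sign⇒±1 (lookup ε i) (≈-from-∣ (g≡ε i)))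

  H-sign : ∀ {g} → InH d g → ∀ i → + g ≈ sign (signBit (lookup d i) g) [mod lookup d i ]
  H-sign (_ , ε , g≡ε) i = ±1⇒sign (d≥3 i) (sign⇒±1 (lookup ε i) (≈-from-∣ (g≡ε i)))

  ±1⇒H : ∀ {g} → InG N g → (∀ i → + g ≈± + 1 [mod lookup d i ]) → InH d g
  ±1⇒H {g} g∈G g≈±1 = g∈G , tabulate (λ i → signBit (lookup d i) g) , λ i →
    ≈-to-∣ (subst (λ s → + g ≈ sign s [mod lookup d i ]) (sym (VecP.lookup∘tabulate _ i)) (±1⇒sign (d≥3 i) (g≈±1 i)))

  stabiliser⊆H : (g : ℕ) → InG N g → (x : Vec ℕ q) → InJs d x → act d g x ≡ x → InH d g
  stabiliser⊆H g g∈G x x∈J fixed = ±1⇒H g∈G λ i →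
    fixes-unit⇒±1 i (proj₂ (x∈J i)) (trans (sym (lookup-act d g x i)) (cong (λ v → lookup v i) fixed))

  _·_ : ℕ → ℕ → ℕ
  a · b = (a * b) % N

  ·-∈G : ∀ {a b} → gcd a N ≡ 1 → gcd b N ≡ 1 → InG N (a · b)
  ·-∈G {a} {b} a⊥N b⊥N = m%n<n (a * b) N ,
    coprime⇒gcd≡1 (≈-coprime (%-≈ (a * b) N) (coprime-* (gcd≡1⇒coprime {a} {N} a⊥N) (gcd≡1⇒coprime {b} {N} b⊥N)))

  act-· : ∀ a b x → act d (a · b) x ≡ act d a (act d b x)
  act-· a b x = trans (act-mod-N x (%-≈ (a * b) N)) (sym (act-∘ a b x))

  module Translation {g₀} (g₀∈G : InG N g₀) where

    u : ℕ
    u = proj₁ (inverse {g₀} {N} (proj₂ g₀∈G))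

    ug₀≈1 : + (u * g₀) ≈ + 1 [mod N ]
    ug₀≈1 = proj₂ (inverse {g₀} {N} (proj₂ g₀∈G))

    u-unit : gcd u N ≡ 1
    u-unit = coprime⇒gcd≡1 {u} {N} (invertible⇒coprime {u} {g₀} ug₀≈1)

    ug₀a≈a : ∀ a → + (u * g₀ * a) ≈ + a [mod N ]
    ug₀a≈a a = subst (λ z → + (u * g₀ * a) ≈ + z [mod N ]) (ℕP.*-identityˡ a) (≈-*ℕ ug₀≈1 (≈-refl (+ a)))

    u-cancels : ∀ a → + (u * (g₀ · a)) ≈ + a [mod N ]
    u-cancels a = ≈-trans (≈-*ℕ (≈-refl (+ u)) (%-≈ (g₀ * a) N))
      (subst (λ z → + z ≈ + a [mod N ]) (ℕP.*-assoc u g₀ a) (ug₀a≈a a))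

    g₀-cancels : ∀ {z} → z < N → g₀ · (u · z) ≡ z
    g₀-cancels {z} z<N = residue-unique (m%n<n _ N) z<N (≈-trans (%-≈ (g₀ * (u · z)) N)
      (≈-trans (≈-*ℕ (≈-refl (+ g₀)) (%-≈ (u * z) N))
        (subst (λ w → + w ≈ + z [mod N ]) (rearrange u g₀ z) (ug₀a≈a z))))
      where
      rearrange : ∀ u g z → u * g * z ≡ g * (u * z)
      rearrange = ℕ-Ring.solve-∀

    u-undoes : ∀ x → InJs d x → act d u (act d g₀ x) ≡ x
    u-undoes x x∈J = begin
      act d u (act d g₀ x)     ≡⟨ act-∘ u g₀ x ⟩
      act d (u * g₀) x         ≡⟨ act-mod-N x ug₀≈1 ⟩
      act d 1 x                ≡⟨ act-trivial 1 x x∈J (λ i → inj₁ (≈-refl (+ 1))) ⟩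
      x                        ∎
      where open ≡-Reasoning

    -- If g₀·x = y, then h ↦ g₀h is a bijection from H onto {g ∈ G : g·x = y},
    -- with inverse z ↦ uz.
    coset-bijection : ∀ x → InJs d x → ∀ {y nH} → act d g₀ x ≡ y →
      HasSize (InH d) nH → HasSize (λ g → InG N g × act d g x ≡ y) nH
    coset-bijection x x∈J {y} g₀x≡y = HasSize-bijection (g₀ ·_) into injective onto
      where
      into : ∀ {h} → InH d h → InG N (g₀ · h) × act d (g₀ · h) x ≡ y
      into {h} h∈H = ·-∈G {g₀} {h} (proj₂ g₀∈G) (proj₂ (proj₁ h∈H)) ,
        trans (act-· g₀ h x) (trans (cong (act d g₀) (H-acts-trivially h h∈H x x∈J)) g₀x≡y)
      injective : ∀ {a b} → InH d a → InH d b → g₀ · a ≡ g₀ · b → a ≡ b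
      injective {a} {b} a∈H b∈H g₀a≡g₀b = residue-unique (proj₁ (proj₁ a∈H)) (proj₁ (proj₁ b∈H))
        (≈-trans (≈-sym (u-cancels a)) (subst (λ z → + (u * z) ≈ + b [mod N ]) (sym g₀a≡g₀b) (u-cancels b)))
      onto : ∀ {z} → InG N z × act d z x ≡ y → ∃ λ h → InH d h × g₀ · h ≡ z
      onto {z} (z∈G , zx≡y) = u · z , stabiliser⊆H (u · z) (·-∈G {u} {z} u-unit (proj₂ z∈G)) x x∈J uz-fixes ,
        g₀-cancels (proj₁ z∈G)
        where
        uz-fixes : act d (u · z) x ≡ x
        uz-fixes = trans (act-· u z x) (trans (cong (act d u) (trans zx≡y (sym g₀x≡y))) (u-undoes x x∈J))

  -- (3) Orbit–stabiliser: G is partitioned by g ↦ g·x into fibres over the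
  -- orbit of x, and each fibre is a coset of H.
  orbit-counting : (x : Vec ℕ q) → InJs d x → (nG nH nO : ℕ) → HasSize (InG N) nG →
    HasSize (InH d) nH → HasSize (InOrbit d x) nO → nO * nH ≡ nG
  orbit-counting x x∈J nG nH nO G-size H-size O-size = sym (count-by-fibres G-size O-size
    (λ {g} g∈G → g , g∈G , refl)
    (λ (g₀ , g₀∈G , g₀x≡y) → Translation.coset-bijection g₀∈G x x∈J g₀x≡y H-size))
    where open Fibres (VecP.≡-dec ℕP._≟_) (λ g → act d g x)

  module Components {c} (components : NumComponents d c) where

    comp : Fin q → Fin c
    comp = proj₁ components

    vertex : Fin c → Fin q
    vertex k = proj₁ (proj₁ (proj₂ components) k)

    same-comp⇔reach : ∀ i j → (comp i ≡ comp j → Reach d i j) × (Reach d i j → comp i ≡ comp j)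
    same-comp⇔reach = proj₂ (proj₂ components)

    -- Along an edge {j, k} of Γ(V), gcd(dⱼ,dₖ) ≥ 3 separates +1 from -1, so an
    -- element of H has the same sign at j and k, hence on whole components.
    sign-constant : ∀ {g} → InH d g → ∀ {i j} → Reach d i j → signBit (lookup d i) g ≡ signBit (lookup d j) g
    sign-constant g∈H here = refl
    sign-constant g∈H (step {j} {k} i⇝j (_ , gcd≥3)) = trans (sign-constant g∈H i⇝j)
      (sign-unique _ _ gcd≥3 (≈-trans (≈-sym (≈-weaken (gcd[m,n]∣m (lookup d j) (lookup d k)) (H-sign g∈H j)))
                                      (≈-weaken (gcd[m,n]∣n (lookup d j) (lookup d k)) (H-sign g∈H k))))

    σ : ℕ → Vec Bool c
    σ g = tabulate (λ k → signBit (lookup d (vertex k)) g)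

    σ-reads-sign : ∀ {g} → InH d g → ∀ i → lookup (σ g) (comp i) ≡ signBit (lookup d i) g
    σ-reads-sign {g} g∈H i = trans (VecP.lookup∘tabulate _ (comp i))
      (sign-constant g∈H (proj₁ (same-comp⇔reach (vertex (comp i)) i) (proj₂ (proj₁ (proj₂ components) (comp i)))))

    -- Elements of H with the same component signs agree modulo every dᵢ, hence modulo N.
    σ-injective : ∀ {g g′} → InH d g → InH d g′ → σ g ≡ σ g′ → g ≡ g′
    σ-injective {g} {g′} g∈H g′∈H σg≡σg′ = residue-unique (proj₁ (proj₁ g∈H)) (proj₁ (proj₁ g′∈H))
      (≈-lcmAll d λ i → ≈-trans (H-sign g∈H i) (≈-sym (subst (λ s → + g′ ≈ sign s [mod lookup d i ])
        (trans (sym (σ-reads-sign g′∈H i)) (trans (cong (λ v → lookup v (comp i)) (sym σg≡σg′)) (σ-reads-sign g∈H i)))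
        (H-sign g′∈H i))))

    -- Every sign vector on the components is realised by some element of H (CRT).
    σ-onto : ∀ (v : Vec Bool c) → ∃ λ g → InH d g × σ g ≡ v
    σ-onto v = g , g∈H , lookup-ext λ k → trans (VecP.lookup∘tabulate _ k)
      (trans (signBit-spec (ε (vertex k)) (d≥3 (vertex k)) (g≈ε (vertex k)))
             (cong (lookup v) (proj₂ (proj₁ (proj₂ components) k))))
      where
      ε : Fin q → Bool
      ε i = lookup v (comp i)
      -- Signs that differ sit in different components, whose moduli have gcd ≤ 2.
      gcd∣2 : ∀ i j → ε i ≢ ε j → gcd (lookup d i) (lookup d j) ∣ 2
      gcd∣2 i j εi≢εj with i Fin.≟ j | 3 ℕP.≤? gcd (lookup d i) (lookup d j)
      ... | yes refl | _        = contradiction refl εi≢εj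
      ... | no i≢j   | yes gcd≥3 = contradiction (cong (lookup v) (proj₂ (same-comp⇔reach i j) (step here (i≢j , gcd≥3)))) εi≢εj
      ... | no _     | no gcd≱3  = small-gcd∣2 (d-pos i) (ℕP.≰⇒> gcd≱3)
      solution : ∃ λ X → ∀ i → X ≈ sign (ε i) [mod lookup d i ]
      solution = crt d d-pos (λ i → sign (ε i)) (λ i j → sign-gap∈ideal _ _ (ε i) (ε j) (gcd∣2 i j))
      g : ℕ
      g = proj₁ solution %ℕ N
      g≈ε : ∀ i → + g ≈ sign (ε i) [mod lookup d i ]
      g≈ε i = ≈-trans (≈-weaken (dᵢ∣N d i) (%ℕ-≈ (proj₁ solution) N)) (proj₂ solution i)
      -- g² ≡ 1 modulo every dᵢ, so g is its own inverse modulo N.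
      g²≈1 : + (g * g) ≈ + 1 [mod N ]
      g²≈1 = ≈-lcmAll d λ i → subst₂ (_≈_[mod lookup d i ]) (sym (ℤP.pos-* g g)) (sign² (ε i)) (≈-* (g≈ε i) (g≈ε i))
        where
        sign² : ∀ s → sign s ℤ.* sign s ≡ + 1
        sign² true  = refl
        sign² false = refl
      g∈H : InH d g
      g∈H = ±1⇒H (n%ℕd<d (proj₁ solution) N , coprime⇒gcd≡1 {g} {N} (invertible⇒coprime {g} {g} g²≈1))
                 (λ i → sign⇒±1 (ε i) (g≈ε i))

    H-size : (nH : ℕ) → HasSize (InH d) nH → nH ≡ 2 ^ c
    H-size nH H-has-nH = HasSize-unique
      (HasSize-bijection σ (λ _ → tt) σ-injective (λ {v} _ → σ-onto v) H-has-nH)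
      (allSigns-size c)

lemma4p3 : (q : ℕ) (d : Vec ℕ q) → (∀ (i : Fin q) → 3 ≤ lookup d i) →
    ((g : ℕ) → InH d g → (x : Vec ℕ q) → InJs d x → act d g x ≡ x)
    × ((g : ℕ) → InG (lcmAll d) g → (x : Vec ℕ q) → InJs d x → act d g x ≡ x → InH d g)
    × ((x : Vec ℕ q) → InJs d x → (nG nH nO : ℕ) → HasSize (InG (lcmAll d)) nG → HasSize (InH d) nH → HasSize (InOrbit d x) nO → nO * nH ≡ nG)
    × ((c nH : ℕ) → NumComponents d c → HasSize (InH d) nH → nH ≡ 2 ^ c)
lemma4p3 q d d≥3 =
    H-acts-trivially
  , stabiliser⊆H
  , orbit-counting
  , λ c nH components → Components.H-size components nH
  where open Lemma d d≥3
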